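{- Let $\ell\ge1$ and let $L^\ell=(G^\ell(V^\ell,W^\ell,E^\ell),\Sigma_V^\ell,\Sigma_W^\ell,\Pi^\ell)$ be the $\ell$-fold parallel repetition of a Label Cover instance $L=(G(V,W,E),(\Sigma_V,\Sigma_W),\Pi)$ in which every vertex of $V$ has degree $3$, every vertex of $W$ has degree $5$, $|\Sigma_V|=7$ and $|\Sigma_W|=2$. Construct the MAX-VOL instance $A$ (with $k=|V^\ell|+|W^\ell|$) as described in the context. If $L^\ell$ has a labeling that satisfies all edges, then there exist $k$ columns of $A$ whose volume is $1$.
   Context: A Label Cover instance $L=(G(V,W,E),(\Sigma_V,\Sigma_W),\Pi)$ consists of a bipartite graph $G$ with sides $V,W$ and edge set $E$, label sets $\Sigma_V,\Sigma_W$, and for each edge $e$ a function $\Pi_e:\Sigma_V\to\Sigma_W$. A labeling $\sigma$ assigns a label in $\Sigma_V$ to each vertex of $V$ and a label in $\Sigma_W$ to each vertex of $W$; it satisfies $e=(v,w)$ if $\Pi_e(\sigma(v))=\sigma(w)$. The $\ell$-fold repetition $L^\ell$ has vertex sets $V^\ell,W^\ell$ ($\ell$-fold Cartesian products), label sets $\Sigma_V^\ell,\Sigma_W^\ell$, edges $E^\ell$ consisting of all pairs $((v_1,\dots,v_\ell),(w_1,\dots,w_\ell))$ with $(v_j,w_j)\in E$ for all $j$, and constraint on such an edge the map $\Pi^\ell_e(i_1,\dots,i_\ell)=(\Pi_{(v_1,w_1)}(i_1),\dots,\Pi_{(v_\ell,w_\ell)}(i_\ell))$. Thus each vertex of $V^\ell$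 has degree $3^\ell$, each vertex of $W^\ell$ has degree $5^\ell$, and we identify $\Sigma_W^\ell$ with $\{1,\dots,2^\ell\}$. Let $b_1,\dots,b_{2^\ell}\in\{0,1\}^{2^{\ell+1}}$ be binary vectors with $\|b_i\|_2=2^{\ell/2}$, $b_i\cdot b_j=2^{\ell-1}$ and $b_i\cdot\overline{b_j}=2^{\ell-1}$ for $i\ne j$ (where $\overline{b}$ is the binary complement, flipping each $0/1$ entry), and set $\hat b_j=b_j/2^{\ell/2}$, $\hat{\bar b}_j=\overline{b_j}/2^{\ell/2}$ (unit vectors). For each $v\in V^\ell$, $i\in\Sigma_V^\ell$ define $A_{v,i}\in\mathbb{R}^{|E^\ell|\cdot 2^{\ell+1}}$, composed of one block in $\mathbb{R}^{2^{\ell+1}}$ per edge $e\in E^\ell$, whose block at $e$ is $\hat{\bar b}_{\Pi^\ell_e(i)}/3^{\ell/2}$ if $e$ is incident to $v$ and $0$ otherwise. For each $w\in W^\ell$, $j\in\Sigma_W^\ell$ define $A_{w,j}$ with block at $e$ equal to $\hat b_j/5^{\ell/2}$ if $e$ is incident to $w$ and $0$ otherwise. The matrix $A$ has as columns all vectors $A_{v,i}$ and $A_{w,j}$, and $k=|V^\ell|+|W^\ell|$. The volume of a set of vectors is the volume of the parallelepiped they span (square root of the Gram determinant). -}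

module Defs where

open import Level using (Level)
open import Data.Nat using (ℕ; zero; suc; _+_; _*_; _^_; _∸_)
open import Data.Fin using (Fin; zero; suc; punchIn; _≟_)
open import Data.Bool using (Bool; true; false; not; if_then_else_)
open import Data.List using (List; []; _∷_; length; filter; map; concatMap; allFin)
open import Data.Vec using (Vec; []; _∷_; zipWith) renaming (map to vmap)
open import Data.Vec.Properties using (≡-dec)
open import Data.Product using (_×_; _,_; proj₁; proj₂)
open import Data.Sum using (_⊎_; inj₁; inj₂)
open import Relation.Nullary using (yes; no; does)
open import Relation.Binary.PropositionalEquality using (_≡_)
open import Algebra.Bundles using (CommutativeRing)
open import Function.Definitions using (Injective)

-- Label Cover instance L = (G(V,W,E), (Σ_V,Σ_W), Π) with V = Fin nV,
-- W = Fin nW, E = Fin m (each edge given by its endpoints; the edge set is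
-- a *set* of pairs, so endpoint pairs are distinct), Σ_V = Fin 7, Σ_W = Fin 2.

record LabelCover : Set where
  field
    nV nW m : ℕ
    src : Fin m → Fin nV
    tgt : Fin m → Fin nW
    Π   : Fin m → Fin 7 → Fin 2
    edges-distinct : ∀ e e′ → src e ≡ src e′ → tgt e ≡ tgt e′ → e ≡ e′

open LabelCover public

degV : (L : LabelCover) → Fin (nV L) → ℕ
degV L v = length (filter (λ e → src L e ≟ v) (allFin (m L)))

degW : (L : LabelCover) → Fin (nW L) → ℕ
degW L w = length (filter (λ e → tgt L e ≟ w) (allFin (m L)))

-- Vertices V^ℓ = Vec (Fin nV) ℓ, W^ℓ = Vec (Fin nW) ℓ,
-- edges E^ℓ = Vec (Fin m) ℓ (a tuple of edges (e_1..e_ℓ) is the edge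
-- ((v_1..v_ℓ),(w_1..w_ℓ)) with (v_j,w_j) = e_j), labels Vec (Fin 7) ℓ,
-- Vec (Fin 2) ℓ.

srcℓ : (L : LabelCover) {ℓ : ℕ} → Vec (Fin (m L)) ℓ → Vec (Fin (nV L)) ℓ
srcℓ L = vmap (src L)

tgtℓ : (L : LabelCover) {ℓ : ℕ} → Vec (Fin (m L)) ℓ → Vec (Fin (nW L)) ℓ
tgtℓ L = vmap (tgt L)

Πℓ : (L : LabelCover) {ℓ : ℕ} → Vec (Fin (m L)) ℓ → Vec (Fin 7) ℓ → Vec (Fin 2) ℓ
Πℓ L es is = zipWith (Π L) es is

SatisfyingLabeling : (L : LabelCover) (ℓ : ℕ) → Set
SatisfyingLabeling L ℓ =
  Σ' (Vec (Fin (nV L)) ℓ → Vec (Fin 7) ℓ) λ σV →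
  Σ' (Vec (Fin (nW L)) ℓ → Vec (Fin 2) ℓ) λ σW →
  ∀ (es : Vec (Fin (m L)) ℓ) → Πℓ L es (σV (srcℓ L es)) ≡ σW (tgtℓ L es)
  where open import Data.Product using () renaming (Σ to Σ')

allVecs : (n ℓ : ℕ) → List (Vec (Fin n) ℓ)
allVecs n zero    = [] ∷ []
allVecs n (suc ℓ) = concatMap (λ x → map (x ∷_) (allVecs n ℓ)) (allFin n)

sumℕ : List ℕ → ℕ
sumℕ [] = 0
sumℕ (x ∷ xs) = x + sumℕ xs

b2n : Bool → ℕ
b2n true = 1
b2n false = 0

dotB : {d : ℕ} → (Fin d → Bool) → (Fin d → Bool) → ℕ
dotB {d} x y = sumℕ (map (λ t → b2n (x t) * b2n (y t)) (allFin d))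

compl : {d : ℕ} → (Fin d → Bool) → (Fin d → Bool)
compl x t = not (x t)

BFamily : (ℓ : ℕ) → Set
BFamily ℓ = Vec (Fin 2) ℓ → Fin (2 ^ (ℓ + 1)) → Bool

GoodBFamily : (ℓ : ℕ) → BFamily ℓ → Set
GoodBFamily ℓ b =
  (∀ i → dotB (b i) (b i) ≡ 2 ^ ℓ) ×
  (∀ i j → ¬' (i ≡ j) → dotB (b i) (b j) ≡ 2 ^ (ℓ ∸ 1)) ×
  (∀ i j → ¬' (i ≡ j) → dotB (b i) (compl (b j)) ≡ 2 ^ (ℓ ∸ 1))
  where open import Relation.Nullary using () renaming (¬_ to ¬')

-- Linear algebra over a commutative ring R (in the paper R = ℝ).
module Lin {c ℓr : Level} (R : CommutativeRing c ℓr) where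
  open CommutativeRing R using (Carrier; 0#; 1#; -_) renaming (_+_ to _+R_; _*_ to _*R_)

  fromℕ : ℕ → Carrier
  fromℕ zero    = 0#
  fromℕ (suc n) = 1# +R fromℕ n

  sumR : List Carrier → Carrier
  sumR [] = 0#
  sumR (x ∷ xs) = x +R sumR xs

  sign : ℕ → Carrier
  sign zero = 1#
  sign (suc n) = - sign n

  toℕF : {n : ℕ} → Fin n → ℕ
  toℕF zero = zero
  toℕF (suc i) = suc (toℕF i)

  det : (n : ℕ) → (Fin n → Fin n → Carrier) → Carrier
  det zero    M = 1#
  det (suc n) M =
    sumR (map (λ j → sign (toℕF j) *R (M zero j *R
                det n (λ r s → M (suc r) (punchIn j s))))
              (allFin (suc n)))

  bitR : Bool → Carrier
  bitR b = if b then 1# else 0#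

  -- The MAX-VOL instance A.  Rows: E^ℓ × Fin 2^{ℓ+1} (one block per edge).
  -- Columns: (V^ℓ × Σ_V^ℓ) ⊎ (W^ℓ × Σ_W^ℓ).
  -- aV stands for 1/(2^{ℓ/2}·3^{ℓ/2}) and aW for 1/(2^{ℓ/2}·5^{ℓ/2}).
  module Instance (L : LabelCover) (ℓ : ℕ) (b : BFamily ℓ) (aV aW : Carrier) where

    Row : Set
    Row = Vec (Fin (m L)) ℓ × Fin (2 ^ (ℓ + 1))

    Col : Set
    Col = (Vec (Fin (nV L)) ℓ × Vec (Fin 7) ℓ) ⊎ (Vec (Fin (nW L)) ℓ × Vec (Fin 2) ℓ)

    allRows : List Row
    allRows = concatMap (λ es → map (es ,_) (allFin (2 ^ (ℓ + 1))))
                        (allVecs (m L) ℓ)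

    entry : Col → Row → Carrier
    entry (inj₁ (vs , is)) (es , t) with ≡-dec _≟_ (srcℓ L es) vs
    ... | yes _ = aV *R bitR (not (b (Πℓ L es is) t))
    ... | no  _ = 0#
    entry (inj₂ (ws , j)) (es , t) with ≡-dec _≟_ (tgtℓ L es) ws
    ... | yes _ = aW *R bitR (b j t)
    ... | no  _ = 0#

    inner : Col → Col → Carrier
    inner x y = sumR (map (λ r → entry x r *R entry y r) allRows)

    -- squared volume of the chosen columns = Gram determinant
    volume² : {k : ℕ} → (Fin k → Col) → Carrier
    volume² {k} cols = det k (λ p q → inner (cols p) (cols q))

module Submission where

-- Given a labelling (σV, σW) of L^ℓ satisfying every edge, choose the k columns
-- A_{v,σV(v)} (v ∈ V^ℓ) and A_{w,σW(w)} (w ∈ W^ℓ).  Their Gram matrix is the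
-- identity, so the (squared) volume is det I = 1:
--   * every column is a unit vector: the column of v is a·b̄ on the 3^ℓ blocks of
--     the edges at v; each b̄ has 2^ℓ ones (its complement b has 2^ℓ of the
--     2^{ℓ+1} coordinates), so its squared norm is a²·3^ℓ·2^ℓ = a²·6^ℓ = 1
--     (similarly a²·5^ℓ·2^ℓ = a²·10^ℓ = 1 for w);
--   * two distinct V-columns (or two W-columns) have disjoint supports;
--   * on an edge e = (v, w) the V-column carries b̄_{Π_e(σV v)} = b̄_{σW w} and
--     the W-column carries b_{σW w}, which is complementary, so they are orthogonal.

open import Defs
open import Level using (Level)
open import Data.Nat using (ℕ; _+_; _*_; _^_; _≥_)
open import Data.Fin using (Fin)
open import Data.Product using (Σ; _×_)
open import Algebra.Bundles using (CommutativeRing)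
open import Function.Definitions using (Injective)
open import Relation.Binary.PropositionalEquality using (_≡_)

open import Data.Nat using (zero; suc)
import Data.Nat.Properties as ℕₚ
open import Algebra.Properties.CommutativeSemigroup ℕₚ.*-commutativeSemigroup using (interchange)
open import Data.Fin using (zero; suc; _≟_; punchIn; remQuot; combine; splitAt; join)
open import Data.Fin.Properties using (suc-injective; combine-remQuot; join-splitAt)
open import Data.Bool using (Bool; true; false; not; _∧_)
open import Data.Bool.Properties using (∧-inverseˡ)
open import Data.List using (List; []; _∷_; _++_; map; concatMap; allFin; tabulate; length; filter)
open import Data.List.Properties using (length-tabulate; map-tabulate)
open import Data.Vec using (Vec; []; _∷_) renaming (map to vmap)
open import Data.Vec.Properties using (≡-dec)
open import Data.Product using (_,_; proj₁; proj₂)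
open import Data.Sum using (_⊎_; inj₁; inj₂)
open import Data.Empty using (⊥-elim)
open import Relation.Nullary using (Dec; yes; no; does; ¬_)
open import Relation.Binary.PropositionalEquality
  using (refl; sym; trans; cong; cong₂; module ≡-Reasoning)
import Relation.Binary.Reasoning.Setoid as SetoidReasoning

ind : ∀ {p} {P : Set p} → Dec P → ℕ
ind d = b2n (does d)

sq : Bool → ℕ
sq β = b2n β * b2n β

b2n-∧ : ∀ β γ → b2n (β ∧ γ) ≡ b2n β * b2n γ
b2n-∧ true  γ = sym (ℕₚ.+-identityʳ (b2n γ))
b2n-∧ false γ = refl

2^suc : ∀ ℓ → 2 ^ (ℓ + 1) ≡ 2 ^ ℓ + 2 ^ ℓ
2^suc zero    = refl
2^suc (suc ℓ) = trans (cong (2 *_) (2^suc ℓ)) (ℕₚ.*-distribˡ-+ 2 (2 ^ ℓ) (2 ^ ℓ))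

*-^ : ∀ m n ℓ → (m * n) ^ ℓ ≡ m ^ ℓ * n ^ ℓ
*-^ m n zero    = refl
*-^ m n (suc ℓ) = trans (cong (m * n *_) (*-^ m n ℓ)) (interchange m n (m ^ ℓ) (n ^ ℓ))

retraction⇒injective : ∀ {a b} {A : Set a} {B : Set b} {f : A → B} (g : B → A) →
  (∀ x → g (f x) ≡ x) → Injective _≡_ _≡_ f
retraction⇒injective g gf {x} {y} e = trans (sym (gf x)) (trans (cong g e) (gf y))

module _ {a} {A : Set a} where

  sumℕ-++ : (f : A → ℕ) (xs ys : List A) →
    sumℕ (map f (xs ++ ys)) ≡ sumℕ (map f xs) + sumℕ (map f ys)
  sumℕ-++ f []       ys = refl
  sumℕ-++ f (x ∷ xs) ys = trans (cong (f x +_) (sumℕ-++ f xs ys)) (sym (ℕₚ.+-assoc (f x) _ _))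

  sumℕ-cong : {f g : A → ℕ} (xs : List A) → (∀ x → f x ≡ g x) → sumℕ (map f xs) ≡ sumℕ (map g xs)
  sumℕ-cong []       h = refl
  sumℕ-cong (x ∷ xs) h = cong₂ _+_ (h x) (sumℕ-cong xs h)

  sumℕ-*ʳ : (f : A → ℕ) (k : ℕ) (xs : List A) →
    sumℕ (map (λ x → f x * k) xs) ≡ sumℕ (map f xs) * k
  sumℕ-*ʳ f k []       = refl
  sumℕ-*ʳ f k (x ∷ xs) = trans (cong (f x * k +_) (sumℕ-*ʳ f k xs)) (sym (ℕₚ.*-distribʳ-+ k (f x) _))

  sumℕ-*ˡ : (k : ℕ) (f : A → ℕ) (xs : List A) →
    sumℕ (map (λ x → k * f x) xs) ≡ k * sumℕ (map f xs)
  sumℕ-*ˡ k f []       = sym (ℕₚ.*-zeroʳ k)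
  sumℕ-*ˡ k f (x ∷ xs) = trans (cong (k * f x +_) (sumℕ-*ˡ k f xs)) (sym (ℕₚ.*-distribˡ-+ k (f x) _))

  length-filter : {P : A → Set} (P? : ∀ x → Dec (P x)) (xs : List A) →
    length (filter P? xs) ≡ sumℕ (map (λ x → ind (P? x)) xs)
  length-filter P? []       = refl
  length-filter P? (x ∷ xs) with does (P? x)
  ... | true  = cong suc (length-filter P? xs)
  ... | false = length-filter P? xs

module _ {a b} {A : Set a} {B : Set b} where

  sumℕ-map : (f : B → ℕ) (h : A → B) (xs : List A) →
    sumℕ (map f (map h xs)) ≡ sumℕ (map (λ x → f (h x)) xs)
  sumℕ-map f h []       = refl
  sumℕ-map f h (x ∷ xs) = cong (f (h x) +_) (sumℕ-map f h xs)

  sumℕ-concatMap : (f : B → ℕ) (g : A → List B) (xs : List A) →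
    sumℕ (map f (concatMap g xs)) ≡ sumℕ (map (λ x → sumℕ (map f (g x))) xs)
  sumℕ-concatMap f g []       = refl
  sumℕ-concatMap f g (x ∷ xs) =
    trans (sumℕ-++ f (g x) (concatMap g xs)) (cong (sumℕ (map f (g x)) +_) (sumℕ-concatMap f g xs))

dotB-compl : ∀ {D} (x : Fin D → Bool) → dotB (compl x) (compl x) + dotB x x ≡ D
dotB-compl {D} x = trans (on-list (allFin D)) (length-tabulate (λ t → t))
  where
  on-list : (ts : List (Fin D)) →
    sumℕ (map (λ t → sq (not (x t))) ts) + sumℕ (map (λ t → sq (x t)) ts) ≡ length ts
  on-list []       = refl
  on-list (t ∷ ts) with x t
  ... | true  = trans (ℕₚ.+-suc _ _) (cong suc (on-list ts))
  ... | false = cong suc (on-list ts)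

dotB-compl-half : ∀ ℓ (x : Fin (2 ^ (ℓ + 1)) → Bool) →
  dotB x x ≡ 2 ^ ℓ → dotB (compl x) (compl x) ≡ 2 ^ ℓ
dotB-compl-half ℓ x hx = ℕₚ.+-cancelʳ-≡ (2 ^ ℓ) _ _ (begin
    dotB (compl x) (compl x) + 2 ^ ℓ    ≡⟨ cong (dotB (compl x) (compl x) +_) (sym hx) ⟩
    dotB (compl x) (compl x) + dotB x x ≡⟨ dotB-compl x ⟩
    2 ^ (ℓ + 1)                         ≡⟨ 2^suc ℓ ⟩
    2 ^ ℓ + 2 ^ ℓ                       ∎)
  where open ≡-Reasoning

Regular : ∀ {m n} → (Fin m → Fin n) → ℕ → Set
Regular {m} f d = ∀ v → length (filter (λ e → f e ≟ v) (allFin m)) ≡ d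

-- If f is d-regular then f applied coordinatewise to ℓ-tuples is d^ℓ-regular:
-- a vertex of the ℓ-fold repetition has degree d^ℓ.
fibre-size : ∀ {m n d} (f : Fin m → Fin n) → Regular f d → ∀ {ℓ} (us : Vec (Fin n) ℓ) →
  sumℕ (map (λ es → ind (≡-dec _≟_ (vmap f es) us)) (allVecs m ℓ)) ≡ d ^ ℓ
fibre-size f reg [] = refl
fibre-size {m} {d = d} f reg {suc ℓ} (u ∷ us) = begin
  sumℕ (map F (concatMap (λ x → map (x ∷_) (allVecs m ℓ)) (allFin m)))
    ≡⟨ sumℕ-concatMap F (λ x → map (x ∷_) (allVecs m ℓ)) (allFin m) ⟩
  sumℕ (map (λ x → sumℕ (map F (map (x ∷_) (allVecs m ℓ)))) (allFin m))
    ≡⟨ sumℕ-cong (allFin m) tuples-starting-with ⟩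
  sumℕ (map (λ x → ind (f x ≟ u) * d ^ ℓ) (allFin m))
    ≡⟨ sumℕ-*ʳ (λ x → ind (f x ≟ u)) (d ^ ℓ) (allFin m) ⟩
  sumℕ (map (λ x → ind (f x ≟ u)) (allFin m)) * d ^ ℓ
    ≡⟨ cong (_* d ^ ℓ) (trans (sym (length-filter (λ x → f x ≟ u) (allFin m))) (reg u)) ⟩
  d * d ^ ℓ ∎
  where
  open ≡-Reasoning
  F : Vec _ (suc ℓ) → ℕ
  F es = ind (≡-dec _≟_ (vmap f es) (u ∷ us))
  -- the tuples x ∷ es over u ∷ us are those with f x = u and es over us
  tuples-starting-with : ∀ x → sumℕ (map F (map (x ∷_) (allVecs m ℓ))) ≡ ind (f x ≟ u) * d ^ ℓ
  tuples-starting-with x = begin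
    sumℕ (map F (map (x ∷_) (allVecs m ℓ)))
      ≡⟨ sumℕ-map F (x ∷_) (allVecs m ℓ) ⟩
    sumℕ (map (λ es → F (x ∷ es)) (allVecs m ℓ))
      ≡⟨ sumℕ-cong (allVecs m ℓ) (λ es → b2n-∧ (does (f x ≟ u)) (does (≡-dec _≟_ (vmap f es) us))) ⟩
    sumℕ (map (λ es → ind (f x ≟ u) * ind (≡-dec _≟_ (vmap f es) us)) (allVecs m ℓ))
      ≡⟨ sumℕ-*ˡ (ind (f x ≟ u)) _ (allVecs m ℓ) ⟩
    ind (f x ≟ u) * sumℕ (map (λ es → ind (≡-dec _≟_ (vmap f es) us)) (allVecs m ℓ))
      ≡⟨ cong (ind (f x ≟ u) *_) (fibre-size f reg us) ⟩
    ind (f x ≟ u) * d ^ ℓ ∎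

rows : (m ℓ D : ℕ) → List (Vec (Fin m) ℓ × Fin D)
rows m ℓ D = concatMap (λ es → map (es ,_) (allFin D)) (allVecs m ℓ)

support : ∀ {m n ℓ D} → (Fin m → Fin n) → Vec (Fin n) ℓ →
  (Vec (Fin m) ℓ → Fin D → Bool) → Vec (Fin m) ℓ × Fin D → ℕ
support f us β (es , t) = ind (≡-dec _≟_ (vmap f es) us) * sq (β es t)

support-size : ∀ {m n d ℓ D} (f : Fin m → Fin n) → Regular f d → (us : Vec (Fin n) ℓ)
  (β : Vec (Fin m) ℓ → Fin D → Bool) (w : ℕ) → (∀ es → dotB (β es) (β es) ≡ w) →
  sumℕ (map (support f us β) (rows m ℓ D)) ≡ d ^ ℓ * w
support-size {m} {ℓ = ℓ} {D} f reg us β w weight = begin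
  sumℕ (map (support f us β) (rows m ℓ D))
    ≡⟨ sumℕ-concatMap (support f us β) (λ es → map (es ,_) (allFin D)) (allVecs m ℓ) ⟩
  sumℕ (map (λ es → sumℕ (map (support f us β) (map (es ,_) (allFin D)))) (allVecs m ℓ))
    ≡⟨ sumℕ-cong (allVecs m ℓ) block ⟩
  sumℕ (map (λ es → incident es * w) (allVecs m ℓ))
    ≡⟨ sumℕ-*ʳ incident w (allVecs m ℓ) ⟩
  sumℕ (map incident (allVecs m ℓ)) * w
    ≡⟨ cong (_* w) (fibre-size f reg us) ⟩
  _ ^ ℓ * w ∎
  where
  open ≡-Reasoning
  incident : Vec (Fin m) ℓ → ℕ
  incident es = ind (≡-dec _≟_ (vmap f es) us)
  block : ∀ es → sumℕ (map (support f us β) (map (es ,_) (allFin D))) ≡ incident es * w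
  block es = begin
    sumℕ (map (support f us β) (map (es ,_) (allFin D)))
      ≡⟨ sumℕ-map (support f us β) (es ,_) (allFin D) ⟩
    sumℕ (map (λ t → incident es * sq (β es t)) (allFin D))
      ≡⟨ sumℕ-*ˡ (incident es) (λ t → sq (β es t)) (allFin D) ⟩
    incident es * dotB (β es) (β es)
      ≡⟨ cong (incident es *_) (weight es) ⟩
    incident es * w ∎

toVec : ∀ {n} ℓ → Fin (n ^ ℓ) → Vec (Fin n) ℓ
toVec zero    _ = []
toVec {n} (suc ℓ) i = proj₁ (remQuot {n} (n ^ ℓ) i) ∷ toVec ℓ (proj₂ (remQuot {n} (n ^ ℓ) i))

fromVec : ∀ {n ℓ} → Vec (Fin n) ℓ → Fin (n ^ ℓ)
fromVec []       = zero
fromVec (x ∷ xs) = combine x (fromVec xs)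

fromVec-toVec : ∀ {n} ℓ (i : Fin (n ^ ℓ)) → fromVec (toVec ℓ i) ≡ i
fromVec-toVec zero    zero = refl
fromVec-toVec {n} (suc ℓ) i =
  trans (cong (combine {n} {n ^ ℓ} _) (fromVec-toVec ℓ _)) (combine-remQuot {n} (n ^ ℓ) i)

module RingFacts {c r : Level} (R : CommutativeRing c r) where
  open CommutativeRing R hiding (zero) renaming (Carrier to C; _+_ to _⊕_; _*_ to _⊗_;
    refl to ≈-refl; sym to ≈-sym; trans to ≈-trans)
  open Lin R
  open SetoidReasoning setoid

  ≡⇒≈ : {x y : C} → x ≡ y → x ≈ y
  ≡⇒≈ refl = ≈-refl

  fromℕ-+ : ∀ m n → fromℕ (m + n) ≈ fromℕ m ⊕ fromℕ n
  fromℕ-+ zero    n = ≈-sym (+-identityˡ _)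
  fromℕ-+ (suc m) n = ≈-trans (+-cong ≈-refl (fromℕ-+ m n)) (≈-sym (+-assoc _ _ _))

  module _ {a} {A : Set a} where

    sumR-cong : {f g : A → C} (xs : List A) → (∀ x → f x ≈ g x) → sumR (map f xs) ≈ sumR (map g xs)
    sumR-cong []       h = ≈-refl
    sumR-cong (x ∷ xs) h = +-cong (h x) (sumR-cong xs h)

    sumR-zero : {f : A → C} (xs : List A) → (∀ x → f x ≈ 0#) → sumR (map f xs) ≈ 0#
    sumR-zero []       h = ≈-refl
    sumR-zero (x ∷ xs) h = ≈-trans (+-cong (h x) (sumR-zero xs h)) (+-identityˡ 0#)

    sumR-fromℕ : (n : A → ℕ) (k : C) (xs : List A) →
      sumR (map (λ x → fromℕ (n x) ⊗ k) xs) ≈ fromℕ (sumℕ (map n xs)) ⊗ k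
    sumR-fromℕ n k []       = ≈-sym (zeroˡ k)
    sumR-fromℕ n k (x ∷ xs) = begin
      fromℕ (n x) ⊗ k ⊕ sumR (map (λ x → fromℕ (n x) ⊗ k) xs)
        ≈⟨ +-cong ≈-refl (sumR-fromℕ n k xs) ⟩
      fromℕ (n x) ⊗ k ⊕ fromℕ (sumℕ (map n xs)) ⊗ k
        ≈⟨ ≈-sym (distribʳ k _ _) ⟩
      (fromℕ (n x) ⊕ fromℕ (sumℕ (map n xs))) ⊗ k
        ≈⟨ *-cong (≈-sym (fromℕ-+ (n x) _)) ≈-refl ⟩
      fromℕ (n x + sumℕ (map n xs)) ⊗ k ∎

  -- A matrix with 1 on the diagonal and 0 off it has determinant 1: in the
  -- Laplace expansion along the first row only the diagonal term survives.
  det-identity : ∀ n (M : Fin n → Fin n → C) →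
    (∀ p → M p p ≈ 1#) → (∀ p q → ¬ p ≡ q → M p q ≈ 0#) → det n M ≈ 1#
  det-identity zero    M diag off = ≈-refl
  det-identity (suc n) M diag off = begin
      term zero ⊕ sumR (map term (tabulate suc))
        ≈⟨ +-cong first-term later-terms ⟩
      1# ⊗ (1# ⊗ 1#) ⊕ 0#  ≈⟨ +-identityʳ _ ⟩
      1# ⊗ (1# ⊗ 1#)       ≈⟨ *-identityˡ _ ⟩
      1# ⊗ 1#              ≈⟨ *-identityˡ _ ⟩
      1# ∎
    where
    term : Fin (suc n) → C
    term j = sign (toℕF j) ⊗ (M zero j ⊗ det n (λ p q → M (suc p) (punchIn j q)))
    first-term : term zero ≈ 1# ⊗ (1# ⊗ 1#)
    first-term = *-cong ≈-refl (*-cong (diag zero)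
      (det-identity n (λ p q → M (suc p) (suc q)) (λ p → diag (suc p))
        (λ p q p≢q → off (suc p) (suc q) (λ e → p≢q (suc-injective e)))))
    later-terms : sumR (map term (tabulate suc)) ≈ 0#
    later-terms = begin
      sumR (map term (tabulate suc))
        ≡⟨ cong sumR (trans (map-tabulate suc term) (sym (map-tabulate (λ j → j) (λ j → term (suc j))))) ⟩
      sumR (map (λ j → term (suc j)) (allFin n))
        ≈⟨ sumR-zero (allFin n) (λ j → ≈-trans (*-cong ≈-refl (≈-trans (*-cong (off zero (suc j) (λ ())) ≈-refl) (zeroˡ _))) (zeroʳ _)) ⟩
      0# ∎

  block : ∀ {p} {P : Set p} → Dec P → C → Bool → C
  block (yes _) a β = a ⊗ bitR β
  block (no _)  a β = 0#

  block-square : ∀ {p} {P : Set p} (d : Dec P) (a : C) (β : Bool) →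
    block d a β ⊗ block d a β ≈ fromℕ (ind d * sq β) ⊗ (a ⊗ a)
  block-square (yes _) a true  = ≈-trans (*-cong (*-identityʳ a) (*-identityʳ a))
    (≈-sym (≈-trans (*-cong (+-identityʳ 1#) ≈-refl) (*-identityˡ _)))
  block-square (yes _) a false = ≈-trans (*-cong (zeroʳ a) ≈-refl) (≈-trans (zeroˡ _) (≈-sym (zeroˡ _)))
  block-square (no _)  a β     = ≈-trans (zeroˡ _) (≈-sym (zeroˡ _))

  block-orthogonal : ∀ {p q} {P : Set p} {Q : Set q} (d : Dec P) (d′ : Dec Q) (a a′ : C) (β β′ : Bool) →
    (P → Q → β ∧ β′ ≡ false) → block d a β ⊗ block d′ a′ β′ ≈ 0#
  block-orthogonal (yes p) (yes q) a a′ β β′ disjoint = bits-orthogonal β β′ (disjoint p q)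
    where
    bits-orthogonal : ∀ β β′ → β ∧ β′ ≡ false → (a ⊗ bitR β) ⊗ (a′ ⊗ bitR β′) ≈ 0#
    bits-orthogonal true  true  ()
    bits-orthogonal true  false _ = ≈-trans (*-cong ≈-refl (zeroʳ a′)) (zeroʳ _)
    bits-orthogonal false β′    _ = ≈-trans (*-cong (zeroʳ a) ≈-refl) (zeroˡ _)
  block-orthogonal (yes _) (no _) a a′ β β′ _ = zeroʳ _
  block-orthogonal (no _)  d′     a a′ β β′ _ = zeroˡ _

  blockCol : ∀ {m n ℓ D} → (Fin m → Fin n) → Vec (Fin n) ℓ → C →
    (Vec (Fin m) ℓ → Fin D → Bool) → Vec (Fin m) ℓ × Fin D → C
  blockCol f us a β (es , t) = block (≡-dec _≟_ (vmap f es) us) a (β es t)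

  blockCol-unit : ∀ {m n d ℓ D} (f : Fin m → Fin n) → Regular f d → (us : Vec (Fin n) ℓ) (a : C)
    (β : Vec (Fin m) ℓ → Fin D → Bool) (w : ℕ) → (∀ es → dotB (β es) (β es) ≡ w) →
    (a ⊗ a) ⊗ fromℕ (d ^ ℓ * w) ≈ 1# →
    sumR (map (λ x → blockCol f us a β x ⊗ blockCol f us a β x) (rows m ℓ D)) ≈ 1#
  blockCol-unit {m} {d = d} {ℓ} {D} f reg us a β w weight normalised = begin
    sumR (map (λ x → blockCol f us a β x ⊗ blockCol f us a β x) (rows m ℓ D))
      ≈⟨ sumR-cong (rows m ℓ D) square ⟩
    sumR (map (λ x → fromℕ (support f us β x) ⊗ (a ⊗ a)) (rows m ℓ D))
      ≈⟨ sumR-fromℕ (support f us β) (a ⊗ a) (rows m ℓ D) ⟩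
    fromℕ (sumℕ (map (support f us β) (rows m ℓ D))) ⊗ (a ⊗ a)
      ≡⟨ cong (λ n → fromℕ n ⊗ (a ⊗ a)) (support-size f reg us β w weight) ⟩
    fromℕ (d ^ ℓ * w) ⊗ (a ⊗ a)
      ≈⟨ *-comm _ _ ⟩
    (a ⊗ a) ⊗ fromℕ (d ^ ℓ * w)
      ≈⟨ normalised ⟩
    1# ∎
    where
    square : ∀ x → blockCol f us a β x ⊗ blockCol f us a β x ≈ fromℕ (support f us β x) ⊗ (a ⊗ a)
    square (es , t) = block-square (≡-dec _≟_ (vmap f es) us) a (β es t)

  blockCol-orthogonal : ∀ {m n n′ ℓ D} (f : Fin m → Fin n) (f′ : Fin m → Fin n′)
    (us : Vec (Fin n) ℓ) (us′ : Vec (Fin n′) ℓ) (a a′ : C) (β β′ : Vec (Fin m) ℓ → Fin D → Bool) →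
    (∀ es t → vmap f es ≡ us → vmap f′ es ≡ us′ → β es t ∧ β′ es t ≡ false) →
    sumR (map (λ x → blockCol f us a β x ⊗ blockCol f′ us′ a′ β′ x) (rows m ℓ D)) ≈ 0#
  blockCol-orthogonal {m} {ℓ = ℓ} {D} f f′ us us′ a a′ β β′ disjoint = sumR-zero (rows m ℓ D) row
    where
    row : ∀ x → blockCol f us a β x ⊗ blockCol f′ us′ a′ β′ x ≈ 0#
    row (es , t) = block-orthogonal (≡-dec _≟_ (vmap f es) us) (≡-dec _≟_ (vmap f′ es) us′)
      a a′ (β es t) (β′ es t) (disjoint es t)

  module ChosenColumns (L : LabelCover) (ℓ : ℕ)
    (regularV : Regular (src L) 3) (regularW : Regular (tgt L) 5)
    (b : BFamily ℓ) (good : GoodBFamily ℓ b) (aV aW : C)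
    (normV : (aV ⊗ aV) ⊗ fromℕ (6 ^ ℓ) ≈ 1#) (normW : (aW ⊗ aW) ⊗ fromℕ (10 ^ ℓ) ≈ 1#)
    (σV : Vec (Fin (nV L)) ℓ → Vec (Fin 7) ℓ) (σW : Vec (Fin (nW L)) ℓ → Vec (Fin 2) ℓ)
    (satisfied : ∀ es → Πℓ L es (σV (srcℓ L es)) ≡ σW (tgtℓ L es)) where
    open Instance L ℓ b aV aW

    column : Col → Row → C
    column (inj₁ (vs , is)) = blockCol (src L) vs aV (λ es → compl (b (Πℓ L es is)))
    column (inj₂ (ws , j))  = blockCol (tgt L) ws aW (λ es → b j)

    entry≡column : ∀ x row → entry x row ≡ column x row
    entry≡column (inj₁ (vs , is)) (es , t) with ≡-dec _≟_ (srcℓ L es) vs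
    ... | yes _ = refl
    ... | no  _ = refl
    entry≡column (inj₂ (ws , j)) (es , t) with ≡-dec _≟_ (tgtℓ L es) ws
    ... | yes _ = refl
    ... | no  _ = refl

    inner≈ : ∀ x y → inner x y ≈ sumR (map (λ row → column x row ⊗ column y row) allRows)
    inner≈ x y = sumR-cong allRows (λ row → ≡⇒≈ (cong₂ _⊗_ (entry≡column x row) (entry≡column y row)))

    inner-comm : ∀ x y → inner x y ≈ inner y x
    inner-comm x y = sumR-cong allRows (λ row → *-comm (entry x row) (entry y row))

    -- Every column is a unit vector: a_V²·3^ℓ·2^ℓ = 1 and a_W²·5^ℓ·2^ℓ = 1, the
    -- complemented patterns b̄_i having weight 2^ℓ like the b_i.
    inner-unit : ∀ x → inner x x ≈ 1#
    inner-unit x@(inj₁ (vs , is)) = ≈-trans (inner≈ x x)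
      (blockCol-unit (src L) regularV vs aV (λ es → compl (b (Πℓ L es is))) (2 ^ ℓ)
        (λ es → dotB-compl-half ℓ (b (Πℓ L es is)) (proj₁ good (Πℓ L es is)))
        (≈-trans (*-cong ≈-refl (≡⇒≈ (cong fromℕ (sym (*-^ 3 2 ℓ))))) normV))
    inner-unit x@(inj₂ (ws , j)) = ≈-trans (inner≈ x x)
      (blockCol-unit (tgt L) regularW ws aW (λ es → b j) (2 ^ ℓ) (λ _ → proj₁ good j)
        (≈-trans (*-cong ≈-refl (≡⇒≈ (cong fromℕ (sym (*-^ 5 2 ℓ))))) normW))

    distinctV : ∀ vs vs′ is is′ → ¬ vs ≡ vs′ → inner (inj₁ (vs , is)) (inj₁ (vs′ , is′)) ≈ 0#
    distinctV vs vs′ is is′ vs≢vs′ = ≈-trans (inner≈ (inj₁ (vs , is)) (inj₁ (vs′ , is′)))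
      (blockCol-orthogonal (src L) (src L) vs vs′ aV aV (λ es → compl (b (Πℓ L es is))) (λ es → compl (b (Πℓ L es is′))) (λ _ _ p q → ⊥-elim (vs≢vs′ (trans (sym p) q))))

    distinctW : ∀ ws ws′ j j′ → ¬ ws ≡ ws′ → inner (inj₂ (ws , j)) (inj₂ (ws′ , j′)) ≈ 0#
    distinctW ws ws′ j j′ ws≢ws′ = ≈-trans (inner≈ (inj₂ (ws , j)) (inj₂ (ws′ , j′)))
      (blockCol-orthogonal (tgt L) (tgt L) ws ws′ aW aW (λ es → b j) (λ es → b j′) (λ _ _ p q → ⊥-elim (ws≢ws′ (trans (sym p) q))))

    -- Since the labelling satisfies the edge es, the V-column of its source carries
    -- b̄_{σW w} and the W-column of its target carries b_{σW w} on that block.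
    complementary : ∀ es t → not (b (Πℓ L es (σV (srcℓ L es))) t) ∧ b (σW (tgtℓ L es)) t ≡ false
    complementary es t rewrite satisfied es = ∧-inverseˡ (b (σW (tgtℓ L es)) t)

    crossing : ∀ vs ws → inner (inj₁ (vs , σV vs)) (inj₂ (ws , σW ws)) ≈ 0#
    crossing vs ws = ≈-trans (inner≈ (inj₁ (vs , σV vs)) (inj₂ (ws , σW ws)))
      (blockCol-orthogonal (src L) (tgt L) vs ws aV aW
        (λ es → compl (b (Πℓ L es (σV vs)))) (λ es → b (σW ws)) λ { es t refl refl → complementary es t })

    data Chosen : Col → Set where
      chosenV : ∀ vs → Chosen (inj₁ (vs , σV vs))
      chosenW : ∀ ws → Chosen (inj₂ (ws , σW ws))

    chosen-orthogonal : ∀ {x y} → Chosen x → Chosen y → ¬ x ≡ y → inner x y ≈ 0#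
    chosen-orthogonal (chosenV vs) (chosenV vs′) x≢y = distinctV vs vs′ _ _ (λ e → x≢y (cong (λ u → inj₁ (u , σV u)) e))
    chosen-orthogonal (chosenW ws) (chosenW ws′) x≢y = distinctW ws ws′ _ _ (λ e → x≢y (cong (λ u → inj₂ (u , σW u)) e))
    chosen-orthogonal (chosenV vs) (chosenW ws)  _   = crossing vs ws
    chosen-orthogonal (chosenW ws) (chosenV vs)  _   =
      ≈-trans (inner-comm (inj₂ (ws , σW ws)) (inj₁ (vs , σV vs))) (crossing vs ws)

    volume-one : ∀ {k} (cols : Fin k → Col) → Injective _≡_ _≡_ cols → (∀ p → Chosen (cols p)) →
      volume² cols ≈ 1#
    volume-one cols injective chosen = det-identity _ _ (λ p → inner-unit (cols p))
      (λ p q p≢q → chosen-orthogonal (chosen p) (chosen q) (λ e → p≢q (injective e)))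

    vertexColumn : Fin (nV L ^ ℓ) ⊎ Fin (nW L ^ ℓ) → Col
    vertexColumn (inj₁ i) = inj₁ (toVec ℓ i , σV (toVec ℓ i))
    vertexColumn (inj₂ j) = inj₂ (toVec ℓ j , σW (toVec ℓ j))

    vertexIndex : Col → Fin (nV L ^ ℓ) ⊎ Fin (nW L ^ ℓ)
    vertexIndex (inj₁ (vs , _)) = inj₁ (fromVec vs)
    vertexIndex (inj₂ (ws , _)) = inj₂ (fromVec ws)

    vertexIndex-vertexColumn : ∀ x → vertexIndex (vertexColumn x) ≡ x
    vertexIndex-vertexColumn (inj₁ i) = cong inj₁ (fromVec-toVec ℓ i)
    vertexIndex-vertexColumn (inj₂ j) = cong inj₂ (fromVec-toVec ℓ j)

    chosenCols : Fin (nV L ^ ℓ + nW L ^ ℓ) → Col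
    chosenCols p = vertexColumn (splitAt (nV L ^ ℓ) p)

    chosenCols-injective : Injective _≡_ _≡_ chosenCols
    chosenCols-injective = retraction⇒injective (λ x → join (nV L ^ ℓ) (nW L ^ ℓ) (vertexIndex x))
      (λ p → trans (cong (join (nV L ^ ℓ) (nW L ^ ℓ)) (vertexIndex-vertexColumn (splitAt (nV L ^ ℓ) p)))
                   (join-splitAt (nV L ^ ℓ) (nW L ^ ℓ) p))

    chosenCols-chosen : ∀ p → Chosen (chosenCols p)
    chosenCols-chosen p with splitAt (nV L ^ ℓ) p
    ... | inj₁ i = chosenV (toVec ℓ i)
    ... | inj₂ j = chosenW (toVec ℓ j)

-- Theorem 4 (completeness): a labelling of L^ℓ satisfying all edges yields k
-- distinct columns of A of volume 1.
mainTheorem4 : ∀ {c r : Level} (R : CommutativeRing c r) (L : LabelCover) (ℓ : ℕ) →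
    ℓ ≥ 1 →
    (∀ v → degV L v ≡ 3) → (∀ w → degW L w ≡ 5) →
    (b : BFamily ℓ) → GoodBFamily ℓ b →
    (aV aW : CommutativeRing.Carrier R) →
    CommutativeRing._≈_ R (CommutativeRing._*_ R (CommutativeRing._*_ R aV aV) (Lin.fromℕ R (6 ^ ℓ))) (CommutativeRing.1# R) →
    CommutativeRing._≈_ R (CommutativeRing._*_ R (CommutativeRing._*_ R aW aW) (Lin.fromℕ R (10 ^ ℓ))) (CommutativeRing.1# R) →
    SatisfyingLabeling L ℓ →
    Σ (Fin (nV L ^ ℓ + nW L ^ ℓ) → Lin.Instance.Col R L ℓ b aV aW) λ cols →
      Injective _≡_ _≡_ cols ×
      CommutativeRing._≈_ R (Lin.Instance.volume² R L ℓ b aV aW cols) (CommutativeRing.1# R)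
mainTheorem4 R L ℓ _ regularV regularW b good aV aW normV normW (σV , σW , satisfied) =
  chosenCols , chosenCols-injective , volume-one chosenCols chosenCols-injective chosenCols-chosen
  where
  open RingFacts.ChosenColumns R L ℓ regularV regularW b good aV aW normV normW σV σW satisfied
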